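{- Let $N$ be a positive integer with $N < 785$. Then any three trinomial coefficients $N!/(x_1!\,x_2!\,x_3!)$, where in each the $x_1,x_2,x_3$ are positive integers with $x_1+x_2+x_3 = N$, have a common divisor greater than $1$. -}

module Defs where

open import Data.Nat.Base using (ℕ; _*_; _!; _/_; _+_; _<_)
open import Relation.Binary.PropositionalEquality using (_≡_)
open import Data.Nat.Properties using (_!≢0; m*n≢0)
open import Data.Product using (_×_)

-- The trinomial coefficient N! / (x₁! x₂! x₃!)  (exact division in ℕ when
-- x₁ + x₂ + x₃ = N).
trinomial : ℕ → ℕ → ℕ → ℕ → ℕ
trinomial N x₁ x₂ x₃ =
  _/_ (N !) ((x₁ ! * x₂ !) * x₃ !)
      {{m*n≢0 (x₁ ! * x₂ !) (x₃ !) {{m*n≢0 (x₁ !) (x₂ !) {{x₁ !≢0}} {{x₂ !≢0}}}} {{x₃ !≢0}}}}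

PosTriple : ℕ → ℕ → ℕ → ℕ → Set
PosTriple N x₁ x₂ x₃ = (0 < x₁) × (0 < x₂) × (0 < x₃) × (x₁ + x₂ + x₃ ≡ N)

-- If the base-p addition of x₁, x₂, x₃ produces a carry, then p divides N!/(x₁! x₂! x₃!)
-- (Kummer). Writing n! = p^⌊n/p⌋ ⌊n/p⌋! w with p ∤ w for the four factorials shows that,
-- up to a unit mod p, the trinomial coefficient of (x₁, x₂, x₃) is p^k times that of
-- (⌊x₁/p⌋, ⌊x₂/p⌋, ⌊x₃/p⌋), where k is the carry out of the last digit; induction on the
-- digits then gives the claim. So it suffices that for N < 785 any three positive triples
-- with sum N all carry at one common prime, a finite statement checked by a certified
-- search: choose a pivot prime, enumerate the (sorted) triples that are carry-free there,
-- and for each one recurse on the remaining triples with the primes at which it carries.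

module Submission where

open import Defs
open import Data.Nat.Base using (ℕ; _<_)
open import Data.Nat.Divisibility using (_∣_)
open import Data.Product using (_×_; ∃-syntax)

open import Data.Bool.Base using (Bool; true; false; T; _∧_; not)
open import Data.Bool.ListAction using (all)
open import Data.Bool.Properties using (T-∧; T-≡)
open import Data.Empty using (⊥-elim)
open import Data.List.Base
  using (List; []; _∷_; _++_; length; upTo; map; concatMap; filter; null; cartesianProductWith)
open import Data.List.Extrema.Nat using (argmin; argmin-all)
open import Data.List.Membership.Propositional using (_∈_; find; lose)
open import Data.List.Membership.Propositional.Properties
  using (∈-filter⁺; ∈-filter⁻; ∈-upTo⁺; ∈-map⁺; ∈-concatMap⁺; ∈-cartesianProductWith⁺; ∈-∃++)
open import Data.List.Properties using (length-++-sucʳ)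
open import Data.List.Relation.Unary.All as All using (All; []; _∷_; all?; lookup; tabulate)
open import Data.List.Relation.Unary.All.Properties using (all⁺; filter⁺; ¬Any⇒All¬)
open import Data.List.Relation.Unary.Any using (here; there; any?)
open import Data.Nat.Base
open import Data.Nat.Combinatorics using (k![n∸k]!∣n!)
open import Data.Nat.DivMod
open import Data.Nat.Divisibility
open import Data.Nat.Primality using (Prime; prime?; prime⇒nonTrivial; euclidsLemma; ¬prime[0]; ¬prime[1])
open import Data.Nat.Properties
open import Data.Nat.Tactic.RingSolver using (solve-∀)
open import Data.Product using (_,_; proj₁; proj₂; ∃₂)
open import Data.Sum.Base using (_⊎_; inj₁; inj₂)
open import Function.Base using (_∘_)
open import Function.Bundles using (Equivalence)
open import Relation.Nullary using (¬_; Dec; yes; no)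
open import Relation.Nullary.Decidable using (T?; ¬?; _×-dec_; from-yes)
open import Relation.Unary using (Decidable)
open import Relation.Binary.PropositionalEquality
open ≡-Reasoning

a!b!∣[a+b]! : ∀ a b → a ! * b ! ∣ (a + b) !
a!b!∣[a+b]! a b = subst (λ n → a ! * n ! ∣ (a + b) !) (m+n∸m≡n a b) (k![n∸k]!∣n! (m≤m+n a b))

a!b!c!∣[a+b+c]! : ∀ a b c → a ! * b ! * c ! ∣ (a + b + c) !
a!b!c!∣[a+b+c]! a b c = ∣-trans (*-monoˡ-∣ (c !) (a!b!∣[a+b]! a b)) (a!b!∣[a+b]! (a + b) c)

a!b!c!≢0 : ∀ a b c → NonZero (a ! * b ! * c !)
a!b!c!≢0 a b c = m*n≢0 (a ! * b !) (c !) {{m*n≢0 (a !) (b !) {{a !≢0}} {{b !≢0}}}} {{c !≢0}}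

multinomial : ℕ → ℕ → ℕ → ℕ
multinomial a b c = trinomial (a + b + c) a b c

multinomial-spec : ∀ a b c → multinomial a b c * (a ! * b ! * c !) ≡ (a + b + c) !
multinomial-spec a b c = m/n*n≡m {{a!b!c!≢0 a b c}} (a!b!c!∣[a+b+c]! a b c)

module _ (p : ℕ) .{{_ : NonZero p}} (a b c : ℕ) where

  a+b+c≡digits+carries : a + b + c ≡ (a % p + b % p + c % p) + (a / p + b / p + c / p) * p
  a+b+c≡digits+carries = begin
    a + b + c
      ≡⟨ cong₂ (λ x y → x + y + c) (m≡m%n+[m/n]*n a p) (m≡m%n+[m/n]*n b p) ⟩
    (a % p + a / p * p) + (b % p + b / p * p) + c
      ≡⟨ cong (_ +_) (m≡m%n+[m/n]*n c p) ⟩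
    (a % p + a / p * p) + (b % p + b / p * p) + (c % p + c / p * p)
      ≡⟨ regroup (a % p) (b % p) (c % p) (a / p) (b / p) (c / p) p ⟩
    (a % p + b % p + c % p) + (a / p + b / p + c / p) * p ∎
    where
    regroup : ∀ x y z u v w p → (x + u * p) + (y + v * p) + (z + w * p) ≡ (x + y + z) + (u + v + w) * p
    regroup = solve-∀

  [a+b+c]/p : (a + b + c) / p ≡ (a / p + b / p + c / p) + (a % p + b % p + c % p) / p
  [a+b+c]/p = begin
    (a + b + c) / p                              ≡⟨ /-congˡ a+b+c≡digits+carries ⟩
    (X + S * p) / p                              ≡⟨ +-distrib-/-∣ʳ X (n∣m*n S) ⟩
    X / p + S * p / p                            ≡⟨ cong (X / p +_) (m*n/n≡m S p) ⟩
    X / p + S                                    ≡⟨ +-comm (X / p) S ⟩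
    S + X / p                                    ∎
    where
    X = a % p + b % p + c % p
    S = a / p + b / p + c / p

  [a+b+c]%p : a % p + b % p + c % p < p → (a + b + c) % p ≡ a % p + b % p + c % p
  [a+b+c]%p X<p = begin
    (a + b + c) % p  ≡⟨ cong (_% p) a+b+c≡digits+carries ⟩
    (X + S * p) % p  ≡⟨ [m+kn]%n≡m%n X S p ⟩
    X % p            ≡⟨ m<n⇒m%n≡m X<p ⟩
    X                ∎
    where
    X = a % p + b % p + c % p
    S = a / p + b / p + c / p

carryFree : ℕ → ℕ → ℕ → ℕ → ℕ → Bool
carryFree zero    _           _ _ _ = true
carryFree (suc f) zero        _ _ _ = true
carryFree (suc f) p@(suc _) a b c =
  (a % p + b % p + c % p <ᵇ p) ∧ carryFree f p (a / p) (b / p) (c / p)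

module _ {p-1 : ℕ} (p-prime : Prime (suc p-1)) where
  private
    p : ℕ
    p = suc p-1

  p∤1 : ¬ p ∣ 1
  p∤1 p∣1 = ¬prime[1] (subst Prime (∣1⇒≡1 p∣1) p-prime)

  p∤m*n : ∀ {m n} → ¬ p ∣ m → ¬ p ∣ n → ¬ p ∣ m * n
  p∤m*n {m} {n} p∤m p∤n p∣mn with euclidsLemma m n p-prime p∣mn
  ... | inj₁ p∣m = p∤m p∣m
  ... | inj₂ p∣n = p∤n p∣n

  p∣m*n∧p∤n⇒p∣m : ∀ {m n} → p ∣ m * n → ¬ p ∣ n → p ∣ m
  p∣m*n∧p∤n⇒p∣m {m} {n} p∣mn p∤n with euclidsLemma m n p-prime p∣mn
  ... | inj₁ p∣m = p∣m
  ... | inj₂ p∣n = ⊥-elim (p∤n p∣n)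

  p∤[1+r+q*p] : ∀ q {r} → suc r < p → ¬ p ∣ suc r + q * p
  p∤[1+r+q*p] q {r} 1+r<p p∣1+r+q*p =
    <⇒≱ 1+r<p (∣⇒≤ (∣m+n∣m⇒∣n (subst (p ∣_) (+-comm (suc r) (q * p)) p∣1+r+q*p) (n∣m*n q)))

  [r+q*p]!≡p^q*q!*unit : ∀ q r → r < p → ∃[ w ] (¬ p ∣ w × (r + q * p) ! ≡ p ^ q * q ! * w)
  [r+q*p]!≡p^q*q!*unit zero    zero    _   = 1 , p∤1 , refl
  [r+q*p]!≡p^q*q!*unit (suc q) zero    _   with [r+q*p]!≡p^q*q!*unit q p-1 ≤-refl
  ... | w , p∤w , eq = w , p∤w , (begin
    suc (p-1 + q * p) * (p-1 + q * p) !     ≡⟨ cong (suc (p-1 + q * p) *_) eq ⟩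
    suc (p-1 + q * p) * (p ^ q * q ! * w)   ≡⟨ regroup p-1 q (p ^ q) (q !) w ⟩
    p * p ^ q * (suc q * q !) * w           ∎)
    where
    regroup : ∀ p-1 q P F w → suc (p-1 + q * suc p-1) * (P * F * w) ≡ suc p-1 * P * (suc q * F) * w
    regroup = solve-∀
  [r+q*p]!≡p^q*q!*unit q       (suc r) 1+r<p with [r+q*p]!≡p^q*q!*unit q r (<⇒≤ 1+r<p)
  ... | w , p∤w , eq = suc (r + q * p) * w , p∤m*n (p∤[1+r+q*p] q 1+r<p) p∤w , (begin
    suc (r + q * p) * (r + q * p) !         ≡⟨ cong (suc (r + q * p) *_) eq ⟩
    suc (r + q * p) * (p ^ q * q ! * w)     ≡⟨ regroup (suc (r + q * p)) (p ^ q) (q !) w ⟩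
    p ^ q * q ! * (suc (r + q * p) * w)     ∎)
    where
    regroup : ∀ x P F w → x * (P * F * w) ≡ P * F * (x * w)
    regroup = solve-∀

  n!≡p^[n/p]*[n/p]!*unit : ∀ n → ∃[ w ] (¬ p ∣ w × n ! ≡ p ^ (n / p) * (n / p) ! * w)
  n!≡p^[n/p]*[n/p]!*unit n with [r+q*p]!≡p^q*q!*unit (n / p) (n % p) (m%n<n n p)
  ... | w , p∤w , eq = w , p∤w , trans (cong _! (m≡m%n+[m/n]*n n p)) eq

  multinomial-digit-step : ∀ a b c → ∃₂ λ w u → ¬ p ∣ w ×
    multinomial a b c * w ≡ p ^ ((a % p + b % p + c % p) / p) * (multinomial (a / p) (b / p) (c / p) * u)
  multinomial-digit-step a b c
    with n!≡p^[n/p]*[n/p]!*unit a | n!≡p^[n/p]*[n/p]!*unit b | n!≡p^[n/p]*[n/p]!*unit c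
       | n!≡p^[n/p]*[n/p]!*unit (a + b + c)
  ... | wa , p∤wa , a!≡ | wb , p∤wb , b!≡ | wc , p∤wc , c!≡ | wN , _ , N!≡ =
    W , R * wN , p∤m*n (p∤m*n p∤wa p∤wb) p∤wc ,
    *-cancelʳ-≡ _ _ (p ^ S * D′) {{m*n≢0 (p ^ S) D′ {{m^n≢0 p S}} {{a!b!c!≢0 a′ b′ c′}}}} (begin
      M * W * (p ^ S * D′)                    ≡⟨ regroup₁ M W (p ^ S) D′ ⟩
      M * (p ^ S * D′ * W)                    ≡⟨ cong (M *_) a!b!c!≡ ⟨
      M * (a ! * b ! * c !)                   ≡⟨ multinomial-spec a b c ⟩
      (a + b + c) !                           ≡⟨ [a+b+c]!≡ ⟩
      p ^ S * p ^ k * (R * (M′ * D′)) * wN    ≡⟨ regroup₂ (p ^ S) (p ^ k) R M′ D′ wN ⟩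
      p ^ k * (M′ * (R * wN)) * (p ^ S * D′)  ∎)
    where
    a′ = a / p
    b′ = b / p
    c′ = c / p
    S = a′ + b′ + c′
    k = (a % p + b % p + c % p) / p
    D′ = a′ ! * b′ ! * c′ !
    W = wa * wb * wc
    M = multinomial a b c
    M′ = multinomial a′ b′ c′
    S!∣[S+k]! = m≤n⇒m!∣n! (m≤m+n S k)
    R = quotient S!∣[S+k]!

    a!b!c!≡ : a ! * b ! * c ! ≡ p ^ S * D′ * W
    a!b!c!≡ = begin
      a ! * b ! * c !
        ≡⟨ cong₂ _*_ (cong₂ _*_ a!≡ b!≡) c!≡ ⟩
      (p ^ a′ * a′ ! * wa) * (p ^ b′ * b′ ! * wb) * (p ^ c′ * c′ ! * wc)
        ≡⟨ regroup (p ^ a′) (p ^ b′) (p ^ c′) (a′ !) (b′ !) (c′ !) wa wb wc ⟩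
      p ^ a′ * p ^ b′ * p ^ c′ * D′ * W
        ≡⟨ cong (λ P → P * D′ * W) p^S≡p^a′*p^b′*p^c′ ⟨
      p ^ S * D′ * W ∎
      where
      p^S≡p^a′*p^b′*p^c′ : p ^ S ≡ p ^ a′ * p ^ b′ * p ^ c′
      p^S≡p^a′*p^b′*p^c′ = trans (^-distribˡ-+-* p (a′ + b′) c′) (cong (_* p ^ c′) (^-distribˡ-+-* p a′ b′))
      regroup : ∀ P Q R x y z u v w →
        (P * x * u) * (Q * y * v) * (R * z * w) ≡ P * Q * R * (x * y * z) * (u * v * w)
      regroup = solve-∀

    [a+b+c]!≡ : (a + b + c) ! ≡ p ^ S * p ^ k * (R * (M′ * D′)) * wN
    [a+b+c]!≡ = begin
      (a + b + c) !
        ≡⟨ N!≡ ⟩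
      p ^ ((a + b + c) / p) * ((a + b + c) / p) ! * wN
        ≡⟨ cong (λ n → p ^ n * n ! * wN) ([a+b+c]/p p a b c) ⟩
      p ^ (S + k) * (S + k) ! * wN
        ≡⟨ cong₂ (λ P F → P * F * wN) (^-distribˡ-+-* p S k) (_∣_.equality S!∣[S+k]!) ⟩
      p ^ S * p ^ k * (R * S !) * wN
        ≡⟨ cong (λ F → p ^ S * p ^ k * (R * F) * wN) (multinomial-spec a′ b′ c′) ⟨
      p ^ S * p ^ k * (R * (M′ * D′)) * wN
        ∎

    regroup₁ : ∀ M W P D → M * W * (P * D) ≡ M * (P * D * W)
    regroup₁ = solve-∀
    regroup₂ : ∀ P Q R M D w → P * Q * (R * (M * D)) * w ≡ Q * (M * (R * w)) * (P * D)
    regroup₂ = solve-∀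

  p∣p^k : ∀ {k} → 0 < k → p ∣ p ^ k
  p∣p^k {suc k} _ = m∣m*n (p ^ k)

  p∣multinomial-step : ∀ a b c →
    p ≤ a % p + b % p + c % p ⊎ p ∣ multinomial (a / p) (b / p) (c / p) → p ∣ multinomial a b c
  p∣multinomial-step a b c carry with multinomial-digit-step a b c
  ... | w , u , p∤w , eq = p∣m*n∧p∤n⇒p∣m (subst (p ∣_) (sym eq) (p∣rhs carry)) p∤w
    where
    p∣rhs : p ≤ a % p + b % p + c % p ⊎ p ∣ multinomial (a / p) (b / p) (c / p) →
            p ∣ p ^ ((a % p + b % p + c % p) / p) * (multinomial (a / p) (b / p) (c / p) * u)
    p∣rhs (inj₁ p≤digitSum) = ∣m⇒∣m*n _ (p∣p^k (m≥n⇒m/n>0 p≤digitSum))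
    p∣rhs (inj₂ p∣M′)      = ∣n⇒∣m*n (p ^ ((a % p + b % p + c % p) / p)) (∣m⇒∣m*n u p∣M′)

  carry⇒p∣multinomial : ∀ f a b c → ¬ T (carryFree f p a b c) → p ∣ multinomial a b c
  carry⇒p∣multinomial zero    a b c carry = ⊥-elim (carry _)
  carry⇒p∣multinomial (suc f) a b c carry with a % p + b % p + c % p <? p
  ... | no  digitSum≮p = p∣multinomial-step a b c (inj₁ (≮⇒≥ digitSum≮p))
  ... | yes digitSum<p = p∣multinomial-step a b c (inj₂ (carry⇒p∣multinomial f (a / p) (b / p) (c / p)
                           (carry ∘ λ noCarry → Equivalence.from T-∧ (<⇒<ᵇ digitSum<p , noCarry))))

carry⇒prime∣multinomial : ∀ {p} → Prime p → ∀ f a b c → ¬ T (carryFree f p a b c) → p ∣ multinomial a b c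
carry⇒prime∣multinomial {zero}  p-prime = ⊥-elim (¬prime[0] p-prime)
carry⇒prime∣multinomial {suc _} p-prime = carry⇒p∣multinomial p-prime

Triple : Set
Triple = ℕ × ℕ × ℕ

total : Triple → ℕ
total (a , b , c) = a + b + c

SortedPositive : Triple → Set
SortedPositive (a , b , c) = 0 < a × a ≤ b × b ≤ c

sortedPositive? : Decidable SortedPositive
sortedPositive? (a , b , c) = 0 <? a ×-dec a ≤? b ×-dec b ≤? c

x+y+z≡y+x+z : ∀ x y z → x + y + z ≡ y + x + z
x+y+z≡y+x+z x y z = cong (_+ z) (+-comm x y)

x+y+z≡x+z+y : ∀ x y z → x + y + z ≡ x + z + y
x+y+z≡x+z+y x y z = trans (+-assoc x y z) (trans (cong (x +_) (+-comm y z)) (sym (+-assoc x z y)))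

carryFree-swap₁₂ : ∀ f p a b c → carryFree f p a b c ≡ carryFree f p b a c
carryFree-swap₁₂ zero    _           _ _ _ = refl
carryFree-swap₁₂ (suc f) zero        _ _ _ = refl
carryFree-swap₁₂ (suc f) p@(suc _) a b c =
  cong₂ (λ s rest → (s <ᵇ p) ∧ rest) (x+y+z≡y+x+z (a % p) (b % p) (c % p))
    (carryFree-swap₁₂ f p (a / p) (b / p) (c / p))

carryFree-swap₂₃ : ∀ f p a b c → carryFree f p a b c ≡ carryFree f p a c b
carryFree-swap₂₃ zero    _           _ _ _ = refl
carryFree-swap₂₃ (suc f) zero        _ _ _ = refl
carryFree-swap₂₃ (suc f) p@(suc _) a b c =
  cong₂ (λ s rest → (s <ᵇ p) ∧ rest) (x+y+z≡x+z+y (a % p) (b % p) (c % p))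
    (carryFree-swap₂₃ f p (a / p) (b / p) (c / p))

Rearrangement : Triple → Triple → Set
Rearrangement (a , b , c) (a′ , b′ , c′) =
  a + b + c ≡ a′ + b′ + c′ × (∀ f p → carryFree f p a b c ≡ carryFree f p a′ b′ c′)

rearrangement-refl : ∀ {t} → Rearrangement t t
rearrangement-refl = refl , λ _ _ → refl

rearrangement-trans : ∀ {s t u} → Rearrangement s t → Rearrangement t u → Rearrangement s u
rearrangement-trans (Σs≡Σt , s≈t) (Σt≡Σu , t≈u) = trans Σs≡Σt Σt≡Σu , λ f p → trans (s≈t f p) (t≈u f p)

swap₁₂ : ∀ {a b c} → Rearrangement (a , b , c) (b , a , c)
swap₁₂ {a} {b} {c} = x+y+z≡y+x+z a b c , λ f p → carryFree-swap₁₂ f p a b c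

swap₂₃ : ∀ {a b c} → Rearrangement (a , b , c) (a , c , b)
swap₂₃ {a} {b} {c} = x+y+z≡x+z+y a b c , λ f p → carryFree-swap₂₃ f p a b c

sortedRearrangement : ∀ {a b c} → 0 < a → 0 < b → 0 < c →
  ∃[ t ] (SortedPositive t × Rearrangement t (a , b , c))
sortedRearrangement {a} {b} {c} 0<a 0<b 0<c with ≤-total a b | ≤-total b c | ≤-total a c
... | inj₁ a≤b | inj₁ b≤c | _        = _ , (0<a , a≤b , b≤c) , rearrangement-refl
... | inj₁ a≤b | inj₂ c≤b | inj₁ a≤c = _ , (0<a , a≤c , c≤b) , swap₂₃
... | inj₁ a≤b | inj₂ c≤b | inj₂ c≤a = _ , (0<c , c≤a , a≤b) , rearrangement-trans swap₁₂ swap₂₃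
... | inj₂ b≤a | inj₁ b≤c | inj₁ a≤c = _ , (0<b , b≤a , a≤c) , swap₁₂
... | inj₂ b≤a | inj₁ b≤c | inj₂ c≤a = _ , (0<b , b≤c , c≤a) , rearrangement-trans swap₂₃ swap₁₂
... | inj₂ b≤a | inj₂ c≤b | _        = _ , (0<c , c≤b , b≤a) ,
                                        rearrangement-trans swap₁₂ (rearrangement-trans swap₂₃ swap₁₂)

compositions : ℕ → List Triple
compositions n = concatMap (λ i → map (λ j → i , j , n ∸ i ∸ j) (upTo (suc (n ∸ i)))) (upTo (suc n))

∈-compositions : ∀ i j k → (i , j , k) ∈ compositions (i + j + k)
∈-compositions i j k =
  ∈-concatMap⁺ row (lose i∈upTo[1+n] (subst (λ l → (i , j , l) ∈ row i) n∸i∸j≡k j∈row[i]))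
  where
  n = i + j + k
  row : ℕ → List Triple
  row i = map (λ j → i , j , n ∸ i ∸ j) (upTo (suc (n ∸ i)))
  n∸i≡j+k : n ∸ i ≡ j + k
  n∸i≡j+k = trans (cong (_∸ i) (+-assoc i j k)) (m+n∸m≡n i (j + k))
  n∸i∸j≡k : n ∸ i ∸ j ≡ k
  n∸i∸j≡k = trans (cong (_∸ j) n∸i≡j+k) (m+n∸m≡n j k)
  i∈upTo[1+n] : i ∈ upTo (suc n)
  i∈upTo[1+n] = ∈-upTo⁺ (s≤s (subst (i ≤_) (sym (+-assoc i j k)) (m≤m+n i (j + k))))
  j∈row[i] : (i , j , n ∸ i ∸ j) ∈ row i
  j∈row[i] = ∈-map⁺ (λ j → i , j , n ∸ i ∸ j) (∈-upTo⁺ (s≤s (subst (j ≤_) (sym n∸i≡j+k) (m≤m+n j k))))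

fromDigits : ℕ → Triple → Triple → Triple
fromDigits p (r₁ , r₂ , r₃) (q₁ , q₂ , q₃) = r₁ + q₁ * p , r₂ + q₂ * p , r₃ + q₃ * p

carryFreeTriples : ℕ → ℕ → ℕ → List Triple
carryFreeTriples zero    _           _ = (0 , 0 , 0) ∷ []
carryFreeTriples (suc f) zero        _ = []
carryFreeTriples (suc f) p@(suc _) n =
  cartesianProductWith (fromDigits p) (compositions (n % p)) (carryFreeTriples f p (n / p))

carryFreeTriples-complete : ∀ f p a b c → T (carryFree f p a b c) → a + b + c < p ^ f →
                            (a , b , c) ∈ carryFreeTriples f p (a + b + c)
carryFreeTriples-complete zero    _ zero    zero    zero    _ _        = here refl
carryFreeTriples-complete zero    _ (suc _) _       _       _ (s≤s ())
carryFreeTriples-complete zero    _ zero    (suc _) _       _ (s≤s ())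
carryFreeTriples-complete zero    _ zero    zero    (suc _) _ (s≤s ())
carryFreeTriples-complete (suc f) p@(suc _) a b c noCarry n<p^[1+f] =
  subst (_∈ carryFreeTriples (suc f) p n) (sym triple≡fromDigits)
    (∈-cartesianProductWith⁺ (fromDigits p) lowDigits∈compositions highParts∈carryFreeTriples)
  where
  n = a + b + c
  digitSum = a % p + b % p + c % p
  S = a / p + b / p + c / p
  digitSum<p : digitSum < p
  digitSum<p = <ᵇ⇒< digitSum p (proj₁ (Equivalence.to T-∧ noCarry))

  lowDigits∈compositions : (a % p , b % p , c % p) ∈ compositions (n % p)
  lowDigits∈compositions =
    subst (λ m → (a % p , b % p , c % p) ∈ compositions m) (sym ([a+b+c]%p p a b c digitSum<p))
      (∈-compositions (a % p) (b % p) (c % p))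

  n/p≡S : n / p ≡ S
  n/p≡S = trans ([a+b+c]/p p a b c) (trans (cong (S +_) (m<n⇒m/n≡0 digitSum<p)) (+-identityʳ S))

  S<p^f : S < p ^ f
  S<p^f = *-cancelʳ-< p S (p ^ f) (≤-<-trans (m≤n+m (S * p) digitSum)
    (subst₂ _<_ (a+b+c≡digits+carries p a b c) (*-comm p (p ^ f)) n<p^[1+f]))

  highParts∈carryFreeTriples : (a / p , b / p , c / p) ∈ carryFreeTriples f p (n / p)
  highParts∈carryFreeTriples = subst (λ m → (a / p , b / p , c / p) ∈ carryFreeTriples f p m) (sym n/p≡S)
    (carryFreeTriples-complete f p (a / p) (b / p) (c / p) (proj₂ (Equivalence.to T-∧ noCarry)) S<p^f)

  triple≡fromDigits : (a , b , c) ≡ fromDigits p (a % p , b % p , c % p) (a / p , b / p , c / p)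
  triple≡fromDigits = cong₂ _,_ (m≡m%n+[m/n]*n a p) (cong₂ _,_ (m≡m%n+[m/n]*n b p) (m≡m%n+[m/n]*n c p))

-- In any base p ≥ 2 a sum below 785 < 2¹⁰ has at most 10 digits.
digits : ℕ
digits = 10

NoCarry : ℕ → Triple → Set
NoCarry p (a , b , c) = T (carryFree digits p a b c)

HasCarry : ℕ → Triple → Set
HasCarry p t = ¬ NoCarry p t

noCarry? : ∀ p → Decidable (NoCarry p)
noCarry? p (a , b , c) = T? (carryFree digits p a b c)

hasCarry? : ∀ p t → Dec (HasCarry p t)
hasCarry? p t = ¬? (noCarry? p t)

Admissible : ℕ → Triple → Set
Admissible N t = SortedPositive t × total t ≡ N

-- The number of carry-free ordered triples with sum n; it only guides the choice of pivot.
searchCost : ℕ → ℕ → ℕ → ℕ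
searchCost zero    _           _ = 1
searchCost (suc f) zero        _ = 1
searchCost (suc f) p@(suc _) n = suc (n % p) * suc (suc (n % p)) / 2 * searchCost f p (n / p)

pivot : ℕ → ℕ → List ℕ → ℕ
pivot N = argmin (λ p → searchCost digits p N)

-- Any k admissible triples with total N carry at a common prime of C: each of them carries at
-- the pivot unless it is one of the enumerated carry-free triples t, and then the other k - 1
-- are covered by the primes at which t carries.
coverable : ℕ → ℕ → List ℕ → Bool
coverable zero    N C        = not (null C)
coverable (suc k) N []       = false
coverable (suc k) N (c ∷ cs) =
  all (λ t → coverable k N (filter (λ q → hasCarry? q t) (c ∷ cs)))
      (filter sortedPositive? (carryFreeTriples digits (pivot N c cs) N))

module _ {a ℓ} {A : Set a} {P : A → Set ℓ} {x : A} {ys : List A} where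

  All-++-∷⁻ : ∀ xs → All P (xs ++ x ∷ ys) → P x × All P (xs ++ ys)
  All-++-∷⁻ []       (px ∷ pys) = px , pys
  All-++-∷⁻ (_ ∷ xs) (py ∷ pxs) = let px , pzs = All-++-∷⁻ xs pxs in px , py ∷ pzs

  All-++-∷⁺ : ∀ xs → P x → All P (xs ++ ys) → All P (xs ++ x ∷ ys)
  All-++-∷⁺ []       px pys        = px ∷ pys
  All-++-∷⁺ (_ ∷ xs) px (py ∷ pzs) = py ∷ All-++-∷⁺ xs px pzs

coverable-child : ∀ k N c cs → T (coverable (suc k) N (c ∷ cs)) → N < pivot N c cs ^ digits →
  ∀ t → Admissible N t → NoCarry (pivot N c cs) t →
  T (coverable k N (filter (λ q → hasCarry? q t) (c ∷ cs)))
coverable-child k N c cs cover N<p^digits t@(x , y , z) (sorted , refl) noCarry =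
  lookup (all⁺ _ _ cover) (∈-filter⁺ sortedPositive? t∈carryFreeTriples sorted)
  where
  t∈carryFreeTriples : t ∈ carryFreeTriples digits (pivot N c cs) N
  t∈carryFreeTriples = carryFreeTriples-complete digits (pivot N c cs) x y z noCarry N<p^digits

coverable-sound : ∀ k N C → T (coverable k N C) → All (λ q → N < q ^ digits) C →
  ∀ R → length R ≡ k → All (Admissible N) R → ∃[ q ] (q ∈ C × All (HasCarry q) R)
coverable-sound zero    N (c ∷ cs) _     _ [] _ _ = c , here refl , []
coverable-sound (suc k) N (c ∷ cs) cover bounds@(c-bound ∷ cs-bounds) R |R|≡1+k admissible
  with any? (noCarry? (pivot N c cs)) R
... | no ¬any =
  pivot N c cs , argmin-all (λ p → searchCost digits p N) (here refl) (tabulate there) , ¬Any⇒All¬ R ¬any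
... | yes any with find any
...   | t , t∈R , noCarry with ∈-∃++ t∈R
...     | xs , ys , refl =
  let t-admissible , rest-admissible = All-++-∷⁻ xs admissible
      q , q∈C′ , rest-carries = coverable-sound k N (filter (λ q → hasCarry? q t) (c ∷ cs))
        (coverable-child k N c cs cover (argmin-all (λ p → searchCost digits p N) c-bound cs-bounds)
          t t-admissible noCarry)
        (filter⁺ (λ q → hasCarry? q t) bounds) (xs ++ ys)
        (suc-injective (trans (sym (length-++-sucʳ xs t ys)) |R|≡1+k)) rest-admissible
      q∈C , t-carries = ∈-filter⁻ (λ q → hasCarry? q t) q∈C′
  in q , q∈C , All-++-∷⁺ xs t-carries rest-carries

-- Opaque, so that goals mentioning coverable 3 N primes for a variable N are not unfolded.
opaque
  primes : List ℕ
  primes =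
    2 ∷ 3 ∷ 5 ∷ 7 ∷ 11 ∷ 13 ∷ 17 ∷ 19 ∷ 23 ∷ 29 ∷ 31 ∷ 37 ∷ 41 ∷ 43 ∷ 47 ∷ 53 ∷
    59 ∷ 61 ∷ 67 ∷ 71 ∷ 73 ∷ 79 ∷ 83 ∷ 89 ∷ 97 ∷ 101 ∷ 103 ∷ 107 ∷ 109 ∷ 113 ∷ 127 ∷ 131 ∷
    137 ∷ 139 ∷ 149 ∷ 151 ∷ 157 ∷ 163 ∷ 167 ∷ 173 ∷ 179 ∷ 181 ∷ 191 ∷ 193 ∷ 197 ∷ 199 ∷ 211 ∷ 223 ∷
    227 ∷ 229 ∷ 233 ∷ 239 ∷ 241 ∷ 251 ∷ 257 ∷ 263 ∷ 269 ∷ 271 ∷ 277 ∷ 281 ∷ 283 ∷ 293 ∷ 307 ∷ 311 ∷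
    313 ∷ 317 ∷ 331 ∷ 337 ∷ 347 ∷ 349 ∷ 353 ∷ 359 ∷ 367 ∷ 373 ∷ 379 ∷ 383 ∷ 389 ∷ 397 ∷ 401 ∷ 409 ∷
    419 ∷ 421 ∷ 431 ∷ 433 ∷ 439 ∷ 443 ∷ 449 ∷ 457 ∷ 461 ∷ 463 ∷ 467 ∷ 479 ∷ 487 ∷ 491 ∷ 499 ∷ 503 ∷
    509 ∷ 521 ∷ 523 ∷ 541 ∷ 547 ∷ 557 ∷ 563 ∷ 569 ∷ 571 ∷ 577 ∷ 587 ∷ 593 ∷ 599 ∷ 601 ∷ 607 ∷ 613 ∷
    617 ∷ 619 ∷ 631 ∷ 641 ∷ 643 ∷ 647 ∷ 653 ∷ 659 ∷ 661 ∷ 673 ∷ 677 ∷ 683 ∷ 691 ∷ 701 ∷ 709 ∷ 719 ∷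
    727 ∷ 733 ∷ 739 ∷ 743 ∷ 751 ∷ 757 ∷ 761 ∷ 769 ∷ 773 ∷ []

  primes-prime : All Prime primes
  primes-prime = from-yes (all? prime? primes)

prime⇒>1 : ∀ {p} → Prime p → 1 < p
prime⇒>1 {p} p-prime = nonTrivial⇒n>1 p {{prime⇒nonTrivial p-prime}}

primes-bounded : ∀ {N} → N < 785 → All (λ q → N < q ^ digits) primes
primes-bounded N<785 = All.map (λ q-prime → <-≤-trans N<785 (≤-trans 785≤2^10 (2^10≤q^10 q-prime))) primes-prime
  where
  2^10≤q^10 : ∀ {q} → Prime q → 2 ^ 10 ≤ q ^ digits
  2^10≤q^10 q-prime = ^-monoˡ-≤ digits (prime⇒>1 q-prime)
  785≤2^10 : 785 ≤ 2 ^ 10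
  785≤2^10 = m≤m+n 785 239

opaque
  unfolding primes

  coverable-upTo785 : all (λ N → coverable 3 N primes) (upTo 785) ≡ true
  coverable-upTo785 = refl

coverable-below785 : ∀ N → N < 785 → T (coverable 3 N primes)
coverable-below785 N N<785 =
  lookup (all⁺ (λ N → coverable 3 N primes) (upTo 785) (Equivalence.from T-≡ coverable-upTo785)) (∈-upTo⁺ N<785)

representative : ∀ {N a b c} → PosTriple N a b c →
  ∃[ t ] (Admissible N t × ∀ {q} → Prime q → HasCarry q t → q ∣ trinomial N a b c)
representative {a = a} {b} {c} (0<a , 0<b , 0<c , refl) with sortedRearrangement 0<a 0<b 0<c
... | t , sorted , (Σt≡Σabc , sameCarries) =
  t , (sorted , Σt≡Σabc) , λ {q} q-prime carry →
    carry⇒prime∣multinomial q-prime digits a b c (carry ∘ subst T (sym (sameCarries digits q)))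

proposition8p5 : (N : ℕ) → 0 < N → N < 785 →
    (a₁ a₂ a₃ b₁ b₂ b₃ c₁ c₂ c₃ : ℕ) →
    PosTriple N a₁ a₂ a₃ → PosTriple N b₁ b₂ b₃ → PosTriple N c₁ c₂ c₃ →
    ∃[ d ] (1 < d × d ∣ trinomial N a₁ a₂ a₃ × d ∣ trinomial N b₁ b₂ b₃ × d ∣ trinomial N c₁ c₂ c₃)
proposition8p5 N _ N<785 a₁ a₂ a₃ b₁ b₂ b₃ c₁ c₂ c₃ A B C
  with representative A | representative B | representative C
... | ta , ta-admissible , ta-carry⇒∣ | tb , tb-admissible , tb-carry⇒∣ | tc , tc-admissible , tc-carry⇒∣ =
  conclude (coverable-sound 3 N primes (coverable-below785 N N<785) (primes-bounded N<785)
              (ta ∷ tb ∷ tc ∷ []) refl (ta-admissible ∷ tb-admissible ∷ tc-admissible ∷ []))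
  where
  conclude : ∃[ q ] (q ∈ primes × All (HasCarry q) (ta ∷ tb ∷ tc ∷ [])) →
    ∃[ d ] (1 < d × d ∣ trinomial N a₁ a₂ a₃ × d ∣ trinomial N b₁ b₂ b₃ × d ∣ trinomial N c₁ c₂ c₃)
  conclude (q , q∈primes , ta-carry ∷ tb-carry ∷ tc-carry ∷ []) =
    q , prime⇒>1 q-prime ,
    ta-carry⇒∣ q-prime ta-carry , tb-carry⇒∣ q-prime tb-carry , tc-carry⇒∣ q-prime tc-carry
    where
    q-prime : Prime q
    q-prime = lookup primes-prime q∈primes
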